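{- Let $v$, $k$ and $\lambda$ be positive integers such that $3 \leq k < v$, and let $r$ and $d$ be the integers such that $\lambda(v-1)=r(k-1)-d$ and $0 \leq d < k-1$. If $d < r-\lambda$, then $$C_{\lambda}(v,k) \geq \left\lceil\frac{v(r+1)}{k+1}\right\rceil.$$
   Context: A $(v,k,\lambda)$-covering is a pair $(V,\mathcal{B})$ where $V$ is a set of $v$ points and $\mathcal{B}$ is a collection (multiset allowed) of $k$-subsets of $V$ (blocks) such that every pair of distinct points lies together in at least $\lambda$ blocks. The covering number $C_\lambda(v,k)$ is the minimum number of blocks in a $(v,k,\lambda)$-covering. -}

module Defs where

open import Data.Nat using (ℕ; suc; _+_; _∸_; _≤_; NonZero)
open import Data.Nat.DivMod using (_/_)
open import Data.Fin using (Fin)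
open import Data.Fin.Subset using (Subset; _∈_; ∣_∣)
open import Data.Fin.Subset.Properties using (_∈?_)
open import Data.List using (List; length; filter)
open import Data.List.Relation.Unary.All using (All)
open import Data.Product using (_×_)
open import Relation.Nullary.Decidable using (_×-dec_)
open import Relation.Binary.PropositionalEquality using (_≡_; _≢_)

⌈_/_⌉ : ℕ → (b : ℕ) → .{{NonZero b}} → ℕ
⌈ a / b ⌉ = (a + b ∸ 1) / b

pairCount : ∀ {v} → List (Subset v) → Fin v → Fin v → ℕ
pairCount 𝓑 x y = length (filter (λ B → (x ∈? B) ×-dec (y ∈? B)) 𝓑)

-- a (v,k,λ)-covering on point set Fin v: a multiset (list) of k-subsets
-- such that every pair of distinct points lies together in ≥ λ blocks
IsCovering : (v k μ : ℕ) → List (Subset v) → Set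
IsCovering v k μ 𝓑 =
  All (λ B → ∣ B ∣ ≡ k) 𝓑 ×
  (∀ (x y : Fin v) → x ≢ y → μ ≤ pairCount 𝓑 x y)

-- For a covering with blocks B₁ … B_b let
-- deg x be the number of blocks through x and pairs x y the number of
-- blocks through x and y.  Counting the pairs through a fixed x gives
-- (k-1)·deg x ≥ λ(v-1), hence deg x ≥ r for every point as d < k-1.  Let I
-- be the set of points of degree ≠ r (so deg x ≥ r+1 there).
--
--  * Double counting incidences: b·k = Σ deg x ≥ r·v + |I|.
--  * Rank argument: no nonzero integer vector z is orthogonal to every block
--    and supported on the points of degree r.  Writing
--    pairs i x = λ + (r-λ)[i = x] + excess i x for i of degree r, with
--    excess ≥ 0 of total d, orthogonality at a coordinate i where |z| is maximal forces
--    (r-λ)|z_i| ≤ d|z_i|, contradicting d < r - λ.  Since fewer than v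
--    homogeneous linear equations in v integer unknowns always have a nonzero
--    integer solution (Gaussian elimination), the b block equations together
--    with the |I| equations z_x = 0 (x ∈ I) number at least v: b + |I| ≥ v.
--
-- Adding the two inequalities gives b(k+1) ≥ v(r+1), and the ceiling bound
-- follows.

module Submission where

open import Defs

open import Data.Nat as ℕ using (ℕ; zero; suc; s≤s)
import Data.Nat.Properties as ℕP
open import Data.Nat.DivMod using (_/_; m<n*o⇒m/o<n)
open import Data.Integer as ℤ using (ℤ; +_; -[1+_]; -_; 0ℤ; 1ℤ; -1ℤ; _+_; _*_; _-_; _≤_; _<_; ∣_∣; nonNegative)
import Data.Integer.Properties as ℤP
open import Data.Integer.Tactic.RingSolver using (solve-∀)
open import Data.Fin using (Fin; zero; suc; punchIn)
open import Data.Fin.Properties using (_≟_; all?; ¬∀⟶∃¬; punchInᵢ≢i)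
open import Data.Vec.Functional using (Vector; insertAt; removeAt)
open import Data.Vec.Functional.Properties using (insertAt-lookup; insertAt-punchIn; removeAt-insertAt)
open import Data.Bool using (true; false; if_then_else_)
open import Data.Fin.Subset using (Subset; inside; outside) renaming (∣_∣ to ∣_∣ˢ)
open import Data.Fin.Subset.Properties using (_∈?_)
open import Data.Vec using ([]; _∷_)
open import Data.List using (List; []; _∷_; _++_; length; map; lookup; allFin; filter; tabulate)
open import Data.List.Properties using (length-map; length-++; length-tabulate)
open import Data.List.Extrema.Nat using (argmax; f[xs]≤f[argmax])
open import Data.List.Membership.Propositional.Properties using (∈-allFin; ∈-filter⁺; ∈-lookup)
open import Data.List.Relation.Unary.All using (All; []; _∷_)
import Data.List.Relation.Unary.All as All
import Data.List.Relation.Unary.All.Properties as AllP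
open import Data.Product using (∃; _×_; _,_)
open import Data.Sum using (_⊎_; inj₁; inj₂; [_,_]′)
open import Data.Empty using (⊥-elim)
open import Relation.Nullary using (¬_; ¬?; Dec; does; yes; no)
open import Relation.Unary using (Pred; Decidable)
open import Relation.Binary.PropositionalEquality
open import Algebra.Properties.Semiring.Sum ℤP.+-*-semiring
  using (sum; sum-syntax; sum-cong-≗; sum-remove; sum-replicate-zero; ∑-distrib-+; ∑-comm; *-distribˡ-sum; *-distribʳ-sum)


∑-mono-≤ : ∀ {n} {f g : Vector ℤ n} → (∀ i → f i ≤ g i) → sum f ≤ sum g
∑-mono-≤ {zero} f≤g = ℤP.≤-refl
∑-mono-≤ {suc n} f≤g = ℤP.+-mono-≤ (f≤g zero) (∑-mono-≤ (λ i → f≤g (suc i)))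

∑-nonneg : ∀ {n} {f : Vector ℤ n} → (∀ i → 0ℤ ≤ f i) → 0ℤ ≤ sum f
∑-nonneg {n} {f} f≥0 = subst (_≤ sum f) (sum-replicate-zero n) (∑-mono-≤ {f = λ _ → 0ℤ} f≥0)

∑-const : ∀ n (c : ℤ) → sum {n} (λ _ → c) ≡ + n * c
∑-const zero c = refl
∑-const (suc n) c = begin
  c + sum {n} (λ _ → c)  ≡⟨ cong (λ s → c + s) (∑-const n c) ⟩
  c + + n * c            ≡⟨ sym (ℤP.suc-* (+ n) c) ⟩
  + suc n * c            ∎
  where open ≡-Reasoning

infix 7 _·_
_·_ : ∀ {n} → Vector ℤ n → Vector ℤ n → ℤ
_·_ {n} a z = ∑[ i < n ] (a i * z i)

𝟙 : ∀ {n} → Vector ℤ n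
𝟙 _ = 1ℤ

·-𝟙 : ∀ {n} (a : Vector ℤ n) → a · 𝟙 ≡ sum a
·-𝟙 a = sum-cong-≗ (λ i → ℤP.*-identityʳ (a i))

·-zeroˡ : ∀ {n} {a : Vector ℤ n} → (∀ i → a i ≡ 0ℤ) → ∀ z → a · z ≡ 0ℤ
·-zeroˡ {n} a≡0 z = trans (sum-cong-≗ (λ i → cong (_* z i) (a≡0 i))) (sum-replicate-zero n)

·-scaleˡ : ∀ {n} (c : ℤ) (u z : Vector ℤ n) → (λ i → c * u i) · z ≡ c * (u · z)
·-scaleˡ c u z = trans (sum-cong-≗ (λ i → ℤP.*-assoc c (u i) (z i))) (sym (*-distribˡ-sum c (λ i → u i * z i)))

·-scaleʳ : ∀ {n} (c : ℤ) (u y : Vector ℤ n) → u · (λ i → c * y i) ≡ c * (u · y)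
·-scaleʳ c u y = trans (sum-cong-≗ (λ i → swap c (u i) (y i))) (sym (*-distribˡ-sum c (λ i → u i * y i)))
  where
  swap : ∀ c x t → x * (c * t) ≡ c * (x * t)
  swap = solve-∀

·-linearˡ : ∀ {n} (α β : ℤ) (u w z : Vector ℤ n) →
            (λ i → α * u i + β * w i) · z ≡ α * (u · z) + β * (w · z)
·-linearˡ α β u w z = begin
  sum (λ i → (α * u i + β * w i) * z i)         ≡⟨ sum-cong-≗ (λ i → distrib α β (u i) (w i) (z i)) ⟩
  sum (λ i → α * (u i * z i) + β * (w i * z i)) ≡⟨ ∑-distrib-+ (λ i → α * (u i * z i)) (λ i → β * (w i * z i)) ⟩
  sum (λ i → α * (u i * z i)) + sum (λ i → β * (w i * z i))
    ≡⟨ sym (cong₂ _+_ (*-distribˡ-sum α (λ i → u i * z i)) (*-distribˡ-sum β (λ i → w i * z i))) ⟩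
  α * (u · z) + β * (w · z)                     ∎
  where
  open ≡-Reasoning
  distrib : ∀ a b x y t → (a * x + b * y) * t ≡ a * (x * t) + b * (y * t)
  distrib = solve-∀

·-removeAt : ∀ {n} (a z : Vector ℤ (suc n)) (p : Fin (suc n)) →
             a · z ≡ a p * z p + removeAt a p · removeAt z p
·-removeAt a z p = sum-remove {i = p} (λ i → a i * z i)

-- Integer solutions of homogeneous linear systems

Nonzero : ∀ {n} → Vector ℤ n → Set
Nonzero z = ∃ λ i → z i ≢ 0ℤ

-- One step of Gaussian elimination with pivot row a and pivot column p:
-- every row g becomes (a p)·g - (g p)·a with column p deleted, and each
-- solution y of the reduced system lifts to a solution of the original one.
module Pivot {n} (a : Vector ℤ (suc n)) (p : Fin (suc n)) where

  eliminate : Vector ℤ (suc n) → Vector ℤ n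
  eliminate g j = a p * removeAt g p j + (- g p) * removeAt a p j

  lift : Vector ℤ n → Vector ℤ (suc n)
  lift y = insertAt (λ j → a p * y j) p (- (removeAt a p · y))

  lift-correct : ∀ g y → g · lift y ≡ eliminate g · y
  lift-correct g y = begin
    g · lift y                                             ≡⟨ ·-removeAt g (lift y) p ⟩
    g p * lift y p + removeAt g p · removeAt (lift y) p    ≡⟨ cong₂ (λ s t → g p * s + t) (insertAt-lookup _ p _) restIdentity ⟩
    g p * (- (removeAt a p · y)) + a p * (removeAt g p · y) ≡⟨ reorder (g p) (a p) (removeAt a p · y) (removeAt g p · y) ⟩
    a p * (removeAt g p · y) + (- g p) * (removeAt a p · y) ≡⟨ sym (·-linearˡ (a p) (- g p) (removeAt g p) (removeAt a p) y) ⟩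
    eliminate g · y                                        ∎
    where
    open ≡-Reasoning
    restIdentity : removeAt g p · removeAt (lift y) p ≡ a p * (removeAt g p · y)
    restIdentity = trans (sum-cong-≗ (λ j → cong (removeAt g p j *_) (removeAt-insertAt _ p _ j)))
                         (·-scaleʳ (a p) (removeAt g p) y)
    reorder : ∀ gp c A G → gp * (- A) + c * G ≡ c * G + (- gp) * A
    reorder = solve-∀

  eliminate-pivot : ∀ j → eliminate a j ≡ 0ℤ
  eliminate-pivot j = cancel (a p) (removeAt a p j)
    where
    cancel : ∀ c x → c * x + (- c) * x ≡ 0ℤ
    cancel = solve-∀

  lift-solves-pivot : ∀ y → a · lift y ≡ 0ℤ
  lift-solves-pivot y = trans (lift-correct a y) (·-zeroˡ eliminate-pivot y)

  lift-solves : ∀ rows y → All (λ g → g · y ≡ 0ℤ) (map eliminate rows) →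
                All (λ g → g · lift y ≡ 0ℤ) rows
  lift-solves rows y sol = All.map (λ {g} g·y≡0 → trans (lift-correct g y) g·y≡0) (AllP.map⁻ sol)

  lift-nonzero : a p ≢ 0ℤ → ∀ y → Nonzero y → Nonzero (lift y)
  lift-nonzero ap≢0 y (j , yj≢0) = punchIn p j , λ liftj≡0 →
    [ ap≢0 , yj≢0 ]′ (ℤP.i*j≡0⇒i≡0∨j≡0 (a p) (trans (sym (insertAt-punchIn _ p _ j)) liftj≡0))

kernel : ∀ {n} (rows : List (Vector ℤ n)) → length rows ℕ.< n →
         ∃ λ z → Nonzero z × All (λ a → a · z ≡ 0ℤ) rows
kernel {suc n} = solve
  where
  solve : (rows : List (Vector ℤ (suc n))) → length rows ℕ.< suc n →
          ∃ λ z → Nonzero z × All (λ a → a · z ≡ 0ℤ) rows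
  solve [] _ = 𝟙 , (zero , λ ()) , []
  solve (a ∷ rows) (s≤s len<n) = byPivot (all? (λ p → a p ℤ.≟ 0ℤ))
    where
    byPivot : Dec (∀ p → a p ≡ 0ℤ) → ∃ λ z → Nonzero z × All (λ g → g · z ≡ 0ℤ) (a ∷ rows)
    byPivot (yes a≡0) =
      let z , z≢0 , sol = solve rows (ℕP.m<n⇒m<1+n len<n) in z , z≢0 , ·-zeroˡ a≡0 z ∷ sol
    byPivot (no a≢0) =
      let p , ap≢0 = ¬∀⟶∃¬ _ _ (λ p → a p ℤ.≟ 0ℤ) a≢0
          open Pivot a p
          y , y≢0 , sol = kernel (map eliminate rows) (subst (ℕ._< n) (sym (length-map eliminate rows)) len<n)
      in lift y , lift-nonzero ap≢0 y y≢0 , lift-solves-pivot y ∷ lift-solves rows y sol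

weighted-bound : ∀ {n} (e w : Vector ℤ n) (M : ℤ) →
                 (∀ x → 0ℤ ≤ e x) → (∀ x → w x ≤ M) → e · w ≤ sum e * M
weighted-bound e w M e≥0 w≤M = begin
  e · w                 ≤⟨ ∑-mono-≤ (λ x → ℤP.*-monoˡ-≤-nonNeg (e x) {{nonNegative (e≥0 x)}} (w≤M x)) ⟩
  sum (λ x → e x * M)   ≡⟨ sym (*-distribʳ-sum M e) ⟩
  sum e * M             ∎
  where open ℤP.≤-Reasoning

≤-abs : ∀ i → i ≤ + ∣ i ∣
≤-abs (+ n) = ℤP.≤-refl
≤-abs -[1+ n ] = ℤ.-≤+

neg-≤-abs : ∀ i → - i ≤ + ∣ i ∣
neg-≤-abs (+ n) = ℤP.neg-≤-pos
neg-≤-abs -[1+ n ] = ℤP.≤-refl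

<⇒suc≤ : ∀ {i j} → i < j → 1ℤ + i ≤ j
<⇒suc≤ {i} {j} i<j = subst (1ℤ + i ≤_) (ℤP.suc-pred j) (ℤP.+-monoʳ-≤ 1ℤ (ℤP.i<j⇒i≤pred[j] i<j))

dominance : ∀ {n} (c : ℤ) (e z : Vector ℤ n) (i : Fin n) →
            (∀ x → 0ℤ ≤ e x) → (∀ x → ∣ z x ∣ ℕ.≤ ∣ z i ∣) →
            c * z i + e · z ≡ 0ℤ → c * + ∣ z i ∣ ≤ sum e * + ∣ z i ∣
dominance c e z i e≥0 zi-max balanced = bySign (ℤP.+∣i∣≡i⊎+∣i∣≡-i (z i))
  where
  open ℤP.≤-Reasoning
  M = + ∣ z i ∣

  c*zi≡-e·z : c * z i ≡ - (e · z)
  c*zi≡-e·z = trans (regroup (c * z i) (e · z))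
                    (trans (cong (λ t → t - e · z) balanced) (ℤP.+-identityˡ (- (e · z))))
    where regroup : ∀ a b → a ≡ (a + b) - b
          regroup = solve-∀

  z≤M : ∀ x → z x ≤ M
  z≤M x = ℤP.≤-trans (≤-abs (z x)) (ℤ.+≤+ (zi-max x))

  -z≤M : ∀ x → -1ℤ * z x ≤ M
  -z≤M x = subst (_≤ M) (sym (ℤP.-1*i≡-i (z x))) (ℤP.≤-trans (neg-≤-abs (z x)) (ℤ.+≤+ (zi-max x)))

  bySign : M ≡ z i ⊎ M ≡ - z i → c * M ≤ sum e * M
  bySign (inj₁ M≡zi) = begin
    c * M                   ≡⟨ cong (c *_) M≡zi ⟩
    c * z i                 ≡⟨ c*zi≡-e·z ⟩
    - (e · z)               ≡⟨ sym (trans (·-scaleʳ -1ℤ e z) (ℤP.-1*i≡-i (e · z))) ⟩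
    e · (λ x → -1ℤ * z x)   ≤⟨ weighted-bound e _ M e≥0 -z≤M ⟩
    sum e * M               ∎
  bySign (inj₂ M≡-zi) = begin
    c * M                   ≡⟨ cong (c *_) M≡-zi ⟩
    c * - z i               ≡⟨ sym (ℤP.neg-distribʳ-* c (z i)) ⟩
    - (c * z i)             ≡⟨ cong -_ c*zi≡-e·z ⟩
    - - (e · z)             ≡⟨ ℤP.neg-involutive (e · z) ⟩
    e · z                   ≤⟨ weighted-bound e z M e≥0 z≤M ⟩
    sum e * M               ∎

length-filter-tabulate : ∀ {a p} {A : Set a} {P : Pred A p} (P? : Decidable P) {n} (g : Fin n → A) →
  + length (filter P? (tabulate g)) ≡ ∑[ i < n ] (if does (P? (g i)) then 1ℤ else 0ℤ)
length-filter-tabulate P? {zero} g = refl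
length-filter-tabulate P? {suc n} g with does (P? (g zero))
... | true = cong (λ s → 1ℤ + s) (length-filter-tabulate P? (λ i → g (suc i)))
... | false = trans (length-filter-tabulate P? (λ i → g (suc i))) (sym (ℤP.+-identityˡ _))

δ : ∀ {n} → Fin n → Vector ℤ n
δ p x = if does (p ≟ x) then 1ℤ else 0ℤ

δ-diag : ∀ {n} (p : Fin n) → δ p p ≡ 1ℤ
δ-diag p with p ≟ p
... | yes _ = refl
... | no p≢p = ⊥-elim (p≢p refl)

δ-off : ∀ {n} {p x : Fin n} → p ≢ x → δ p x ≡ 0ℤ
δ-off {p = p} {x} p≢x with p ≟ x
... | yes p≡x = ⊥-elim (p≢x p≡x)
... | no _ = refl

δ-· : ∀ {n} (p : Fin (suc n)) (z : Vector ℤ (suc n)) → δ p · z ≡ z p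
δ-· p z = begin
  δ p · z                                        ≡⟨ ·-removeAt (δ p) z p ⟩
  δ p p * z p + removeAt (δ p) p · removeAt z p  ≡⟨ cong₂ (λ s t → s * z p + t) (δ-diag p) (·-zeroˡ offPivot (removeAt z p)) ⟩
  1ℤ * z p + 0ℤ                                  ≡⟨ trans (ℤP.+-identityʳ _) (ℤP.*-identityˡ (z p)) ⟩
  z p                                            ∎
  where
  open ≡-Reasoning
  offPivot : ∀ j → δ p (punchIn p j) ≡ 0ℤ
  offPivot j = δ-off (λ p≡ → punchInᵢ≢i p j (sym p≡))

-- Incidence structures

χ : ∀ {v} → Subset v → Vector ℤ v
χ B x = if does (x ∈? B) then 1ℤ else 0ℤ

χ-idem : ∀ {v} (B : Subset v) x → χ B x * χ B x ≡ χ B x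
χ-idem B x with does (x ∈? B)
... | true = refl
... | false = refl

∑χ : ∀ {v} (B : Subset v) → sum (χ B) ≡ + ∣ B ∣ˢ
∑χ [] = refl
∑χ (inside ∷ B) = cong (λ s → 1ℤ + s) (∑χ B)
∑χ (outside ∷ B) = trans (ℤP.+-identityˡ _) (∑χ B)

∑-swap-· : ∀ {b v} (f : Fin b → Vector ℤ v) (z : Vector ℤ v) →
           (λ x → ∑[ j < b ] f j x) · z ≡ ∑[ j < b ] (f j · z)
∑-swap-· f z = begin
  sum (λ x → sum (λ j → f j x) * z x)  ≡⟨ sum-cong-≗ (λ x → *-distribʳ-sum (z x) (λ j → f j x)) ⟩
  sum (λ x → sum (λ j → f j x * z x))  ≡⟨ ∑-comm (λ x j → f j x * z x) ⟩
  sum (λ j → f j · z)                  ∎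
  where open ≡-Reasoning

module Incidence {v} (𝓑 : List (Subset v)) where

  b : ℕ
  b = length 𝓑

  N : Fin b → Vector ℤ v
  N j = χ (lookup 𝓑 j)

  deg : Vector ℤ v
  deg x = ∑[ j < b ] N j x

  pairs : Fin v → Vector ℤ v
  pairs x y = ∑[ j < b ] (N j x * N j y)

  pairs-diag : ∀ x → pairs x x ≡ deg x
  pairs-diag x = sum-cong-≗ (λ j → χ-idem (lookup 𝓑 j) x)

  deg-· : ∀ z → deg · z ≡ ∑[ j < b ] (N j · z)
  deg-· = ∑-swap-· N

  pairs-· : ∀ x z → pairs x · z ≡ ∑[ j < b ] (N j x * (N j · z))
  pairs-· x z = trans (∑-swap-· (λ j y → N j x * N j y) z) (sum-cong-≗ (λ j → ·-scaleˡ (N j x) (N j) z))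

  module Orthogonal (z : Vector ℤ v) (z⊥N : ∀ j → N j · z ≡ 0ℤ) where

    deg⊥ : deg · z ≡ 0ℤ
    deg⊥ = trans (deg-· z) (trans (sum-cong-≗ z⊥N) (sum-replicate-zero b))

    pairs⊥ : ∀ x → pairs x · z ≡ 0ℤ
    pairs⊥ x = trans (pairs-· x z) (trans (sum-cong-≗ vanish) (sum-replicate-zero b))
      where
      vanish : ∀ j → N j x * (N j · z) ≡ 0ℤ
      vanish j = trans (cong (N j x *_) (z⊥N j)) (ℤP.*-zeroʳ (N j x))

  module Uniform (k : ℕ) (uniform : ∀ j → ∣ lookup 𝓑 j ∣ˢ ≡ k) where

    N·𝟙 : ∀ j → N j · 𝟙 ≡ + k
    N·𝟙 j = trans (·-𝟙 (N j)) (trans (∑χ (lookup 𝓑 j)) (cong +_ (uniform j)))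

    deg-total : sum deg ≡ + b * + k
    deg-total = begin
      sum deg                  ≡⟨ sym (·-𝟙 deg) ⟩
      deg · 𝟙                  ≡⟨ deg-· 𝟙 ⟩
      ∑[ j < b ] (N j · 𝟙)     ≡⟨ sum-cong-≗ N·𝟙 ⟩
      sum {b} (λ _ → + k)      ≡⟨ ∑-const b (+ k) ⟩
      + b * + k                ∎
      where open ≡-Reasoning

    pairs-row : ∀ x → sum (pairs x) ≡ deg x * + k
    pairs-row x = begin
      sum (pairs x)                   ≡⟨ sym (·-𝟙 (pairs x)) ⟩
      pairs x · 𝟙                     ≡⟨ pairs-· x 𝟙 ⟩
      ∑[ j < b ] (N j x * (N j · 𝟙))  ≡⟨ sum-cong-≗ (λ j → cong (N j x *_) (N·𝟙 j)) ⟩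
      ∑[ j < b ] (N j x * + k)        ≡⟨ sym (*-distribʳ-sum (+ k) (λ j → N j x)) ⟩
      deg x * + k                     ∎
      where open ≡-Reasoning

pairCount≡pairs : ∀ {v} (𝓑 : List (Subset v)) x y → + pairCount 𝓑 x y ≡ Incidence.pairs 𝓑 x y
pairCount≡pairs [] x y = refl
pairCount≡pairs (B ∷ 𝓑) x y with does (x ∈? B) | does (y ∈? B)
... | true  | true  = cong (λ s → 1ℤ + s) (pairCount≡pairs 𝓑 x y)
... | true  | false = trans (pairCount≡pairs 𝓑 x y) (sym (ℤP.+-identityˡ _))
... | false | true  = trans (pairCount≡pairs 𝓑 x y) (sym (ℤP.+-identityˡ _))
... | false | false = trans (pairCount≡pairs 𝓑 x y) (sym (ℤP.+-identityˡ _))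

-- Coverings

-- A design on v = V + 1 points whose blocks have size k = K + 1 and in which
-- every two distinct points lie together in at least μ blocks.
module Covering {V : ℕ} (𝓑 : List (Subset (suc V))) (K μ : ℕ)
  (uniform : ∀ j → ∣ lookup 𝓑 j ∣ˢ ≡ suc K)
  (covers : ∀ x y → x ≢ y → μ ℕ.≤ pairCount 𝓑 x y) where

  open Incidence 𝓑
  open Uniform (suc K) uniform

  -- By how much the pair counts through x exceed the covering requirement,
  -- the diagonal entry pairs x x = deg x being corrected to μ.
  excess : Fin (suc V) → Vector ℤ (suc V)
  excess x y = pairs x y - + μ - (deg x - + μ) * δ x y

  -- Off the diagonal this is the covering condition; on it excess x x = 0.
  excess-nonneg : ∀ x y → 0ℤ ≤ excess x y
  excess-nonneg x y = byEquality (x ≟ y)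
    where
    open ℤP.≤-Reasoning
    byEquality : Dec (x ≡ y) → 0ℤ ≤ excess x y
    byEquality (yes refl) = ℤP.≤-reflexive (sym diagonal)
      where
      diagonal : excess x x ≡ 0ℤ
      diagonal rewrite pairs-diag x | δ-diag x = cancel (deg x) (+ μ)
        where cancel : ∀ D m → D - m - (D - m) * 1ℤ ≡ 0ℤ
              cancel = solve-∀
    byEquality (no x≢y) = begin
      0ℤ                                   ≤⟨ ℤP.i≤j⇒0≤j-i μ≤pairs ⟩
      pairs x y - + μ                      ≡⟨ drop (pairs x y - + μ) (deg x - + μ) ⟨
      pairs x y - + μ - (deg x - + μ) * 0ℤ ≡⟨ cong (λ t → pairs x y - + μ - (deg x - + μ) * t) (δ-off x≢y) ⟨
      excess x y                           ∎
      where
      μ≤pairs : + μ ≤ pairs x y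
      μ≤pairs = subst (+ μ ≤_) (pairCount≡pairs 𝓑 x y) (ℤ.+≤+ (covers x y x≢y))
      drop : ∀ a c → a - c * 0ℤ ≡ a
      drop = solve-∀

  pairs-split : ∀ x z → pairs x · z ≡ + μ * sum z + (deg x - + μ) * z x + excess x · z
  pairs-split x z = begin
    pairs x · z                                           ≡⟨ sum-cong-≗ (λ y → cong (_* z y) (split y)) ⟩
    (λ y → 1ℤ * main y + 1ℤ * excess x y) · z             ≡⟨ ·-linearˡ 1ℤ 1ℤ main (excess x) z ⟩
    1ℤ * (main · z) + 1ℤ * (excess x · z)
      ≡⟨ cong (λ t → 1ℤ * t + 1ℤ * (excess x · z)) (·-linearˡ (+ μ) c 𝟙 (δ x) z) ⟩
    1ℤ * (+ μ * (𝟙 · z) + c * (δ x · z)) + 1ℤ * (excess x · z)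
      ≡⟨ cong₂ (λ s t → 1ℤ * (+ μ * s + c * t) + 1ℤ * (excess x · z))
               (sum-cong-≗ (λ y → ℤP.*-identityˡ (z y))) (δ-· x z) ⟩
    1ℤ * (+ μ * sum z + c * z x) + 1ℤ * (excess x · z)   ≡⟨ unit (+ μ * sum z) (c * z x) (excess x · z) ⟩
    + μ * sum z + c * z x + excess x · z                  ∎
    where
    open ≡-Reasoning
    c = deg x - + μ
    main : Vector ℤ (suc V)
    main y = + μ * 𝟙 y + c * δ x y
    split : ∀ y → pairs x y ≡ 1ℤ * main y + 1ℤ * excess x y
    split y = resplit (pairs x y) (+ μ) c (δ x y)
      where resplit : ∀ p m c t → p ≡ 1ℤ * (m * 1ℤ + c * t) + 1ℤ * (p - m - c * t)
            resplit = solve-∀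
    unit : ∀ a b e → 1ℤ * (a + b) + 1ℤ * e ≡ a + b + e
    unit = solve-∀

  excess-total : ∀ x → sum (excess x) ≡ deg x * + K - + μ * + V
  excess-total x = begin
    sum (excess x)                                             ≡⟨ sym (·-𝟙 (excess x)) ⟩
    excess x · 𝟙                                               ≡⟨ isolate (pairs-split x 𝟙) ⟩
    pairs x · 𝟙 - (+ μ * sum {suc V} 𝟙 + (deg x - + μ) * 1ℤ)
      ≡⟨ cong₂ (λ s t → s - (+ μ * t + (deg x - + μ) * 1ℤ)) (trans (·-𝟙 (pairs x)) (pairs-row x)) (∑-const (suc V) 1ℤ) ⟩
    deg x * + suc K - (+ μ * (+ suc V * 1ℤ) + (deg x - + μ) * 1ℤ) ≡⟨ simplify (deg x) (+ μ) (+ K) (+ V) ⟩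
    deg x * + K - + μ * + V                                    ∎
    where
    open ≡-Reasoning
    isolate : ∀ {a b e} → a ≡ b + e → e ≡ a - b
    isolate {a} {b} {e} a≡b+e = trans (regroup b e) (cong (_- b) (sym a≡b+e))
      where regroup : ∀ b e → e ≡ b + e - b
            regroup = solve-∀
    simplify : ∀ D m K V → D * (1ℤ + K) - (m * ((1ℤ + V) * 1ℤ) + (D - m) * 1ℤ) ≡ D * K - m * V
    simplify = solve-∀

  degree-bound : ∀ x → + μ * + V ≤ deg x * + K
  degree-bound x = ℤP.0≤i-j⇒j≤i (subst (0ℤ ≤_) (excess-total x) (∑-nonneg (excess-nonneg x)))

  module Parameters (r d : ℕ) (balance : + μ * + V + + d ≡ + r * + K) where

    r≤deg : d ℕ.< K → ∀ x → + r ≤ deg x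
    r≤deg d<K x with + r ℤ.≤? deg x
    ... | yes r≤deg = r≤deg
    ... | no r≰deg = ⊥-elim (ℤP.<⇒≱ degTooSmall (degree-bound x))
      where
      open ℤP.≤-Reasoning
      degTooSmall : deg x * + K < + μ * + V
      degTooSmall = begin-strict
        deg x * + K           ≤⟨ ℤP.*-monoʳ-≤-nonNeg (+ K) (ℤP.i<j⇒i≤pred[j] (ℤP.≰⇒> r≰deg)) ⟩
        ℤ.pred (+ r) * + K    ≡⟨ expand (+ r) (+ K) ⟩
        + r * + K - + K       <⟨ ℤP.+-monoʳ-< (+ r * + K) (ℤP.neg-mono-< (ℤ.+<+ d<K)) ⟩
        + r * + K - + d       ≡⟨ cong (_- + d) balance ⟨
        + μ * + V + + d - + d ≡⟨ cancel (+ μ * + V) (+ d) ⟩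
        + μ * + V             ∎
        where
        expand : ∀ r K → (-1ℤ + r) * K ≡ r * K - K
        expand = solve-∀
        cancel : ∀ a d → a + d - d ≡ a
        cancel = solve-∀

    excess-regular : ∀ x → deg x ≡ + r → sum (excess x) ≡ + d
    excess-regular x deg≡r = begin
      sum (excess x)              ≡⟨ excess-total x ⟩
      deg x * + K - + μ * + V     ≡⟨ cong (λ t → t * + K - + μ * + V) deg≡r ⟩
      + r * + K - + μ * + V       ≡⟨ cong (_- + μ * + V) balance ⟨
      + μ * + V + + d - + μ * + V ≡⟨ cancel (+ μ * + V) (+ d) ⟩
      + d                         ∎
      where
      open ≡-Reasoning
      cancel : ∀ a d → a + d - a ≡ d
      cancel = solve-∀

    irregular? : (x : Fin (suc V)) → Dec (deg x ≢ + r)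
    irregular? x = ¬? (deg x ℤ.≟ + r)

    irregular : List (Fin (suc V))
    irregular = filter irregular? (allFin (suc V))

    incidence-count : d ℕ.< K → + r * + suc V + + length irregular ≤ + b * + suc K
    incidence-count d<K = begin
      + r * + suc V + + length irregular   ≡⟨ cong₂ _+_ (trans (ℤP.*-comm (+ r) (+ suc V)) (sym (∑-const (suc V) (+ r))))
                                                         (length-filter-tabulate irregular? (λ x → x)) ⟩
      sum {suc V} (λ _ → + r) + sum c      ≡⟨ ∑-distrib-+ (λ _ → + r) c ⟨
      sum (λ x → + r + c x)                ≤⟨ ∑-mono-≤ above ⟩
      sum deg                              ≡⟨ deg-total ⟩
      + b * + suc K                        ∎
      where
      open ℤP.≤-Reasoning
      c : Vector ℤ (suc V)
      c x = if does (irregular? x) then 1ℤ else 0ℤ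
      above : ∀ x → + r + c x ≤ deg x
      above x with deg x ℤ.≟ + r
      ... | yes _ = subst (_≤ deg x) (sym (ℤP.+-identityʳ (+ r))) (r≤deg d<K x)
      ... | no deg≢r = subst (_≤ deg x) (ℤP.+-comm 1ℤ (+ r))
                             (<⇒suc≤ (ℤP.≤∧≢⇒< (r≤deg d<K x) (λ r≡deg → deg≢r (sym r≡deg))))

    module Rank (gap : d ℕ.+ μ ℕ.< r) where

      r≢0 : r ≢ 0
      r≢0 r≡0 = ℕP.n≮0 (subst (d ℕ.+ μ ℕ.<_) r≡0 gap)

      r-μ≰d : ¬ (+ r - + μ ≤ + d)
      r-μ≰d r-μ≤d = ℤP.<⇒≱ (ℤ.+<+ gap) (begin
        + r                 ≡⟨ shift (+ r) (+ μ) ⟩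
        + r - + μ + + μ     ≤⟨ ℤP.+-monoˡ-≤ (+ μ) r-μ≤d ⟩
        + d + + μ           ≡⟨ ℤP.pos-+ d μ ⟨
        + (d ℕ.+ μ)         ∎)
        where
        open ℤP.≤-Reasoning
        shift : ∀ r m → r ≡ r - m + m
        shift = solve-∀

      -- No nonzero vector supported on the points of degree r is orthogonal
      -- to every block: at a coordinate i where |z| is maximal, orthogonality
      -- to row i of the pair-count matrix reads (r-μ)z_i + excess i · z = 0,
      -- and diagonal dominance then forces r - μ ≤ d.
      regular-null : ∀ z → (∀ j → N j · z ≡ 0ℤ) → (∀ x → deg x ≢ + r → z x ≡ 0ℤ) → ¬ Nonzero z
      regular-null z z⊥N support (p , zp≢0) =
        r-μ≰d (ℤP.*-cancelʳ-≤-pos (+ r - + μ) (+ d) M {{ℤ.positive M>0}} dominated)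
        where
        open Orthogonal z z⊥N

        i : Fin (suc V)
        i = argmax (λ x → ∣ z x ∣) zero (allFin (suc V))

        maximal : ∀ x → ∣ z x ∣ ℕ.≤ ∣ z i ∣
        maximal x = All.lookup (f[xs]≤f[argmax] {f = λ y → ∣ z y ∣} zero (allFin (suc V))) (∈-allFin x)

        -- z i ≠ 0, so i has degree r
        ∣zi∣≢0 : ∣ z i ∣ ≢ 0
        ∣zi∣≢0 ∣zi∣≡0 = zp≢0 (ℤP.∣i∣≡0⇒i≡0 (ℕP.n≤0⇒n≡0 (subst (∣ z p ∣ ℕ.≤_) ∣zi∣≡0 (maximal p))))

        M : ℤ
        M = + ∣ z i ∣

        M>0 : 0ℤ < M
        M>0 = ℤ.+<+ (ℕP.n≢0⇒n>0 ∣zi∣≢0)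

        deg-i : deg i ≡ + r
        deg-i with deg i ℤ.≟ + r
        ... | yes deg≡r = deg≡r
        ... | no deg≢r = ⊥-elim (∣zi∣≢0 (cong ∣_∣ (support i deg≢r)))

        -- r·Σz = deg·z = 0
        r*Σz≡0 : + r * sum z ≡ 0ℤ
        r*Σz≡0 = begin
          + r * sum z               ≡⟨ *-distribˡ-sum (+ r) z ⟩
          sum (λ x → + r * z x)     ≡⟨ sum-cong-≗ regular ⟩
          deg · z                   ≡⟨ deg⊥ ⟩
          0ℤ                        ∎
          where
          open ≡-Reasoning
          regular : ∀ x → + r * z x ≡ deg x * z x
          regular x with deg x ℤ.≟ + r
          ... | yes deg≡r = cong (_* z x) (sym deg≡r)
          ... | no deg≢r rewrite support x deg≢r = trans (ℤP.*-zeroʳ (+ r)) (sym (ℤP.*-zeroʳ (deg x)))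

        Σz≡0 : sum z ≡ 0ℤ
        Σz≡0 with ℤP.i*j≡0⇒i≡0∨j≡0 (+ r) r*Σz≡0
        ... | inj₁ r≡0 = ⊥-elim (r≢0 (cong ∣_∣ r≡0))
        ... | inj₂ Σz≡0 = Σz≡0

        balanced : (+ r - + μ) * z i + excess i · z ≡ 0ℤ
        balanced = begin
          (+ r - + μ) * z i + excess i · z                     ≡⟨ addZero (+ μ) ((+ r - + μ) * z i) (excess i · z) ⟩
          + μ * 0ℤ + (+ r - + μ) * z i + excess i · z
            ≡⟨ cong₂ (λ s t → + μ * s + (t - + μ) * z i + excess i · z) Σz≡0 deg-i ⟨
          + μ * sum z + (deg i - + μ) * z i + excess i · z     ≡⟨ pairs-split i z ⟨
          pairs i · z                                          ≡⟨ pairs⊥ i ⟩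
          0ℤ                                                   ∎
          where
          open ≡-Reasoning
          addZero : ∀ m a e → a + e ≡ m * 0ℤ + a + e
          addZero = solve-∀

        dominated : (+ r - + μ) * M ≤ + d * M
        dominated = subst (λ t → (+ r - + μ) * M ≤ t * M) (excess-regular i deg-i)
                          (dominance (+ r - + μ) (excess i) z i (excess-nonneg i) maximal balanced)

      constraints : List (Vector ℤ (suc V))
      constraints = tabulate N ++ map δ irregular

      length-constraints : length constraints ≡ b ℕ.+ length irregular
      length-constraints = trans (length-++ (tabulate N)) (cong₂ ℕ._+_ (length-tabulate N) (length-map δ irregular))

      -- The rank argument: the constraints have no nonzero common solution,
      -- so there are at least v of them.
      point-count : suc V ℕ.≤ b ℕ.+ length irregular
      point-count with suc V ℕP.≤? b ℕ.+ length irregular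
      ... | yes v≤ = v≤
      ... | no v≰ with kernel constraints (subst (ℕ._< suc V) (sym length-constraints) (ℕP.≰⇒> v≰))
      ...   | z , z≢0 , solves = ⊥-elim (regular-null z blocks⊥ supported z≢0)
        where
        blocks⊥ : ∀ j → N j · z ≡ 0ℤ
        blocks⊥ = AllP.tabulate⁻ (AllP.++⁻ˡ (tabulate N) solves)
        supported : ∀ x → deg x ≢ + r → z x ≡ 0ℤ
        supported x deg≢r = trans (sym (δ-· x z))
          (All.lookup (AllP.map⁻ (AllP.++⁻ʳ (tabulate N) solves)) (∈-filter⁺ irregular? (∈-allFin x) deg≢r))

      covering-bound : d ℕ.< K → suc V ℕ.* (r ℕ.+ 1) ℕ.≤ b ℕ.* suc (suc K)
      covering-bound d<K =
        ℤP.drop‿+≤+ (subst₂ _≤_ (sym (ℤP.pos-* (suc V) (r ℕ.+ 1))) (sym (ℤP.pos-* b (suc (suc K)))) (begin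
          + suc V * + (r ℕ.+ 1)             ≡⟨ cong (+ suc V *_) (ℤP.pos-+ r 1) ⟩
          + suc V * (+ r + 1ℤ)              ≡⟨ regroup (+ suc V) (+ r) I ⟩
          + r * + suc V + I + + suc V - I   ≤⟨ ℤP.+-monoˡ-≤ (- I) (ℤP.+-mono-≤ (incidence-count d<K) points) ⟩
          + b * + suc K + (+ b + I) - I     ≡⟨ regroup′ (+ b) (+ K) I ⟩
          + b * + suc (suc K)               ∎))
        where
        open ℤP.≤-Reasoning
        I = + length irregular
        points : + suc V ≤ + b + I
        points = subst (+ suc V ≤_) (ℤP.pos-+ b (length irregular)) (ℤ.+≤+ point-count)
        regroup : ∀ v r I → v * (r + 1ℤ) ≡ r * v + I + v - I
        regroup = solve-∀
        regroup′ : ∀ b K I → b * (1ℤ + K) + (b + I) - I ≡ b * (1ℤ + (1ℤ + K))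
        regroup′ = solve-∀

⌈/⌉-≤ : ∀ a b m → a ℕ.≤ b ℕ.* suc m → ⌈ a / suc m ⌉ ℕ.≤ b
⌈/⌉-≤ a b m a≤bm = subst (λ t → t / suc m ℕ.≤ b) (sym (cong (ℕ._∸ 1) (ℕP.+-suc a m)))
                          (ℕP.<⇒≤pred (m<n*o⇒m/o<n a+m<[1+b]m))
  where
  a+m<[1+b]m : a ℕ.+ m ℕ.< suc b ℕ.* suc m
  a+m<[1+b]m = subst (a ℕ.+ m ℕ.<_) (ℕP.+-comm (b ℕ.* suc m) (suc m)) (ℕP.+-mono-≤-< a≤bm (ℕP.n<1+n m))

theorem1p1 : (v k μ r d : ℕ) → 1 ℕ.≤ μ → 3 ℕ.≤ k → k ℕ.< v →
    μ ℕ.* (v ℕ.∸ 1) ℕ.+ d ≡ r ℕ.* (k ℕ.∸ 1) → d ℕ.< k ℕ.∸ 1 → d ℕ.+ μ ℕ.< r →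
    (𝓑 : List (Subset v)) → IsCovering v k μ 𝓑 →
    ⌈ v ℕ.* (r ℕ.+ 1) / suc k ⌉ ℕ.≤ length 𝓑
theorem1p1 zero _ _ _ _ _ _ () _ _ _ _ _
theorem1p1 (suc V) (suc K) μ r d _ _ _ balance d<K gap 𝓑 (sizes , covers) =
  ⌈/⌉-≤ (suc V ℕ.* (r ℕ.+ 1)) (length 𝓑) (suc K) (Rank.covering-bound gap d<K)
  where
  uniform : ∀ j → ∣ lookup 𝓑 j ∣ˢ ≡ suc K
  uniform j = All.lookup sizes (∈-lookup j)

  balanceℤ : + μ * + V + + d ≡ + r * + K
  balanceℤ = begin
    + μ * + V + + d       ≡⟨ cong (_+ + d) (ℤP.pos-* μ V) ⟨
    + (μ ℕ.* V) + + d     ≡⟨ ℤP.pos-+ (μ ℕ.* V) d ⟨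
    + (μ ℕ.* V ℕ.+ d)     ≡⟨ cong +_ balance ⟩
    + (r ℕ.* K)           ≡⟨ ℤP.pos-* r K ⟩
    + r * + K             ∎
    where open ≡-Reasoning

  open Covering.Parameters 𝓑 K μ uniform covers r d balanceℤ
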